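{- Let $n\ge2$ be a natural number and let $\mathbb F_2$ be the free group on generators $\sigma,\tau$. Define $\gamma_0:=\sigma^{n-1}$, $\gamma_1:=\tau\sigma^{n-2}$, and $\gamma_i:=\sigma^{ -i+1}\tau\sigma^{i-2}$ for $2\le i<n$. Then for each $\omega\in\mathbb F_2$ there is a partition $\mathbb F_2=A_0\sqcup B_0\sqcup\dots\sqcup A_{n-1}\sqcup B_{n-1}$ of $\mathbb F_2$ into $2n$ subsets such that the identity $\varepsilon$ and $\omega$ belong to the same element of the partition, and such that $\gamma_i(B_i)=\mathbb F_2-A_i$ for all $i<n$.
   Context: For $\gamma\in\mathbb F_2$ and $E\subseteq\mathbb F_2$, $\gamma(E):=\{\gamma\beta:\beta\in E\}$ (left multiplication). $\varepsilon$ denotes the empty word (identity). -}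

module Defs where

open import Data.Bool using (Bool; true; false; not; _∧_; T)
open import Data.Unit using (⊤; tt)
open import Data.Empty using (⊥)
open import Data.List using (List; []; _∷_; foldr; foldl)
open import Data.Product using (Σ; _,_; _×_; proj₁; proj₂)
open import Data.Nat using (ℕ; zero; suc; _∸_)
open import Data.Fin using (Fin; toℕ)
open import Relation.Binary.PropositionalEquality using (_≡_)
open import Relation.Unary using (Pred)
open import Level using (0ℓ)

data Letter : Set where
  s s⁻ t t⁻ : Letter

invL : Letter → Letter
invL s = s⁻
invL s⁻ = s
invL t = t⁻
invL t⁻ = t

cancels : Letter → Letter → Bool
cancels s s⁻ = true
cancels s⁻ s = true
cancels t t⁻ = true
cancels t⁻ t = true
cancels _ _ = false

isRed : List Letter → Bool
isRed [] = true
isRed (a ∷ []) = true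
isRed (a ∷ b ∷ w) = not (cancels a b) ∧ isRed (b ∷ w)

F2 : Set
F2 = Σ (List Letter) (λ w → T (isRed w))

cons : Letter → List Letter → List Letter
cons a [] = a ∷ []
cons a (b ∷ w) with cancels a b
... | true = w
... | false = a ∷ b ∷ w

red-tail : ∀ b w → T (isRed (b ∷ w)) → T (isRed w)
red-tail b [] p = tt
red-tail b (c ∷ w) p with cancels b c
... | false = p

cons-red : ∀ a w → T (isRed w) → T (isRed (cons a w))
cons-red a [] p = tt
cons-red a (b ∷ w) p with cancels a b in eq
... | true = red-tail b w p
... | false rewrite eq = p

ε : F2
ε = [] , tt

mulW : List Letter → List Letter → List Letter
mulW w v = foldr cons v w

mulW-red : ∀ w v → T (isRed v) → T (isRed (mulW w v))
mulW-red [] v p = p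
mulW-red (a ∷ w) v p = cons-red a (mulW w v) (mulW-red w v p)

infixl 7 _·_
_·_ : F2 → F2 → F2
(w , _) · (v , q) = mulW w v , mulW-red w v q

letter : Letter → F2
letter a = (a ∷ []) , tt

σ τ σ⁻¹ : F2
σ = letter s
τ = letter t
σ⁻¹ = letter s⁻

_^_ : F2 → ℕ → F2
x ^ zero = ε
x ^ suc k = x · (x ^ k)

γ′ : ℕ → ℕ → F2
γ′ n zero = σ ^ (n ∸ 1)
γ′ n (suc zero) = τ · (σ ^ (n ∸ 2))
γ′ n (suc (suc k)) = (σ⁻¹ ^ suc k) · τ · (σ ^ k)

γ : (n : ℕ) → Fin n → F2
γ n i = γ′ n (toℕ i)

_⟨_⟩ : F2 → Pred F2 0ℓ → Pred F2 0ℓ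
g ⟨ E ⟩ = λ x → Σ F2 (λ β → E β × (g · β ≡ x))

-- the two kinds of blocks A_i / B_i of the partition
data Side : Set where
  sideA sideB : Side

-- The γ_i freely generate a subgroup H of index n − 1, with coset representatives σ^{-q}
-- for q ≤ n − 2. Reidemeister–Schreier rewriting maps x ∈ F₂ to a reduced word Φ x over the
-- letters γ_i^{±1}, and Φ (γ_i x) is Φ x freely multiplied on the left by γ_i. Labelling
-- reduced words by their first letter is then the classical ping-pong partition, except
-- that the empty word has no first letter: instead all powers of the generator underlying
-- the first letter c of Φ ω get the label c, which keeps the ping-pong identities and puts
-- ε in the block of ω.
module Submission where

open import Defs
open import Data.Nat using (ℕ; zero; suc; _+_; _≤_; _<_; _<?_; s≤s; z≤n)
open import Data.Nat.Properties using (≤-refl; ≤-trans; m≤m+n; <⇒≤; +-suc; +-identityʳ; ≤-antisym; ≮⇒≥; <-irrefl)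
open import Data.Fin using (Fin; toℕ) renaming (zero to fzero; suc to fsuc)
open import Data.Fin.Properties using (toℕ<n) renaming (_≟_ to _≟ᶠ_)
open import Data.Bool using (true; false; T)
open import Data.Bool.Properties using (T-irrelevant)
open import Data.Unit using (⊤; tt)
open import Data.Empty using (⊥-elim)
open import Data.List using (List; []; _∷_; _++_; replicate; head)
open import Data.List.Properties using (foldr-++)
open import Data.List.Relation.Unary.All as All using (All; []; _∷_; all?)
open import Data.Maybe using (Maybe; just; nothing; fromMaybe)
open import Data.Maybe.Properties using (just-injective)
import Data.Maybe as Maybe
open import Data.Product using (Σ; ∃; _×_; _,_; proj₁; proj₂)
open import Data.Product.Properties using (≡-dec)
open import Function using (_∘_)
open import Relation.Binary.Definitions using (DecidableEquality)
open import Relation.Binary.PropositionalEquality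
  using (_≡_; _≢_; refl; sym; trans; cong; subst; module ≡-Reasoning)
open import Relation.Nullary using (¬_; Dec; yes; no)
open import Relation.Unary using (_≐_; ∁)

F2-≡ : {x y : F2} → proj₁ x ≡ proj₁ y → x ≡ y
F2-≡ {w , p} {.w , q} refl = cong (w ,_) (T-irrelevant p q)

cancels⇒≡invL : ∀ a b → cancels a b ≡ true → b ≡ invL a
cancels⇒≡invL s s⁻ _ = refl
cancels⇒≡invL s⁻ s _ = refl
cancels⇒≡invL t t⁻ _ = refl
cancels⇒≡invL t⁻ t _ = refl
cancels⇒≡invL s s ()
cancels⇒≡invL s t ()
cancels⇒≡invL s t⁻ ()
cancels⇒≡invL s⁻ s⁻ ()
cancels⇒≡invL s⁻ t ()
cancels⇒≡invL s⁻ t⁻ ()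
cancels⇒≡invL t s ()
cancels⇒≡invL t s⁻ ()
cancels⇒≡invL t t ()
cancels⇒≡invL t⁻ s ()
cancels⇒≡invL t⁻ s⁻ ()
cancels⇒≡invL t⁻ t⁻ ()

cancels-self : ∀ a → cancels a a ≡ false
cancels-self s = refl
cancels-self s⁻ = refl
cancels-self t = refl
cancels-self t⁻ = refl

invL-involutive : ∀ a → invL (invL a) ≡ a
invL-involutive s = refl
invL-involutive s⁻ = refl
invL-involutive t = refl
invL-involutive t⁻ = refl

cons-reduced : ∀ a w → T (isRed (a ∷ w)) → cons a w ≡ a ∷ w
cons-reduced a [] _ = refl
cons-reduced a (b ∷ w) r with cancels a b
... | true = ⊥-elim r
... | false = refl

cons-invL : ∀ a v → T (isRed v) → cons a (cons (invL a) v) ≡ v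
cons-invL s [] _ = refl
cons-invL s⁻ [] _ = refl
cons-invL t [] _ = refl
cons-invL t⁻ [] _ = refl
cons-invL a (b ∷ w) r with cancels (invL a) b in eq
... | true rewrite cancels⇒≡invL (invL a) b eq | invL-involutive a = cons-reduced a w r
... | false with a
... | s = refl
... | s⁻ = refl
... | t = refl
... | t⁻ = refl

invW : List Letter → List Letter
invW [] = []
invW (a ∷ u) = invW u ++ invL a ∷ []

mulW-invW : ∀ u v → T (isRed v) → mulW u (mulW (invW u) v) ≡ v
mulW-invW [] v _ = refl
mulW-invW (a ∷ u) v r = begin
  cons a (mulW u (mulW (invW u ++ invL a ∷ []) v))   ≡⟨ cong (cons a ∘ mulW u) (foldr-++ cons v (invW u) _) ⟩
  cons a (mulW u (mulW (invW u) (cons (invL a) v)))  ≡⟨ cong (cons a) (mulW-invW u _ (cons-red (invL a) v r)) ⟩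
  cons a (cons (invL a) v)                           ≡⟨ cons-invL a v r ⟩
  v                                                  ∎
  where open ≡-Reasoning

·-divideˡ : (g x : F2) → ∃ λ β → g · β ≡ x
·-divideˡ (u , _) (v , r) = (mulW (invW u) v , mulW-red (invW u) v r) , F2-≡ (mulW-invW u v r)

cons-replicate : ∀ a k → cons a (replicate k a) ≡ a ∷ replicate k a
cons-replicate a zero = refl
cons-replicate a (suc k) rewrite cancels-self a = refl

letter-^ : ∀ a k → proj₁ (letter a ^ k) ≡ replicate k a
letter-^ a zero = refl
letter-^ a (suc k) = trans (cong (cons a) (letter-^ a k)) (cons-replicate a k)

cons-t-σ^ : ∀ k → cons t (replicate k s) ≡ t ∷ replicate k s
cons-t-σ^ zero = refl
cons-t-σ^ (suc k) = refl

mulW-s⁻-t : ∀ c v → mulW (replicate c s⁻) (t ∷ v) ≡ replicate c s⁻ ++ t ∷ v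
mulW-s⁻-t zero v = refl
mulW-s⁻-t (suc zero) v = refl
mulW-s⁻-t (suc (suc c)) v rewrite mulW-s⁻-t (suc c) v = refl

γ-word : ∀ k → proj₁ ((σ⁻¹ ^ suc k) · τ · (σ ^ k)) ≡ replicate (suc k) s⁻ ++ t ∷ replicate k s
γ-word k rewrite letter-^ s⁻ (suc k) | letter-^ s k | mulW-s⁻-t (suc k) []
  | foldr-++ cons (replicate k s) (replicate (suc k) s⁻) (t ∷ []) | cons-t-σ^ k = mulW-s⁻-t (suc k) (replicate k s)

flip : Side → Side
flip sideA = sideB
flip sideB = sideA

_≟ˢ_ : DecidableEquality Side
sideA ≟ˢ sideA = yes refl
sideA ≟ˢ sideB = no λ ()
sideB ≟ˢ sideA = no λ ()
sideB ≟ˢ sideB = yes refl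

-- Reduced words in the free group on generators indexed by I: (i , sideA) is the i-th
-- generator and (i , sideB) its inverse, matching the blocks A_i and B_i.
module FreeWord {I : Set} (_≟ᴵ_ : DecidableEquality I) where

  Gen : Set
  Gen = I × Side

  inv : Gen → Gen
  inv (i , x) = i , flip x

  inv-involutive : ∀ g → inv (inv g) ≡ g
  inv-involutive (i , sideA) = refl
  inv-involutive (i , sideB) = refl

  _≟_ : DecidableEquality Gen
  _≟_ = ≡-dec _≟ᴵ_ _≟ˢ_

  Reduced : List Gen → Set
  Reduced [] = ⊤
  Reduced (g ∷ []) = ⊤
  Reduced (g ∷ h ∷ r) = h ≢ inv g × Reduced (h ∷ r)

  Reduced-tail : ∀ g r → Reduced (g ∷ r) → Reduced r
  Reduced-tail g [] _ = tt
  Reduced-tail g (h ∷ r) (_ , p) = p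

  Reduced-head : ∀ g r → Reduced (g ∷ r) → head r ≢ just (inv g)
  Reduced-head g [] _ ()
  Reduced-head g (h ∷ r) (h≢ , _) refl = h≢ refl

  infixr 5 _◁_ _◁?_

  _◁_ : Gen → List Gen → List Gen
  g ◁ [] = g ∷ []
  g ◁ (h ∷ r) with h ≟ inv g
  ... | yes _ = r
  ... | no _ = g ∷ h ∷ r

  ◁-cancel : ∀ g r → g ◁ inv g ∷ r ≡ r
  ◁-cancel g r with inv g ≟ inv g
  ... | yes _ = refl
  ... | no ne = ⊥-elim (ne refl)

  ◁-extend : ∀ g k → head k ≢ just (inv g) → g ◁ k ≡ g ∷ k
  ◁-extend g [] _ = refl
  ◁-extend g (h ∷ r) h≢ with h ≟ inv g
  ... | yes e = ⊥-elim (h≢ (cong just e))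
  ... | no _ = refl

  ◁-reduced : ∀ g k → Reduced k → Reduced (g ◁ k)
  ◁-reduced g [] _ = tt
  ◁-reduced g (h ∷ r) p with h ≟ inv g
  ... | yes _ = Reduced-tail h r p
  ... | no h≢ = h≢ , p

  inv-◁-◁ : ∀ g k → Reduced k → inv g ◁ g ◁ k ≡ k
  inv-◁-◁ g [] _ = subst (λ h → inv g ◁ h ∷ [] ≡ []) (inv-involutive g) (◁-cancel (inv g) [])
  inv-◁-◁ g (h ∷ r) p with h ≟ inv g
  ... | yes refl = ◁-extend (inv g) r (Reduced-head (inv g) r p)
  ... | no _ = subst (λ h′ → inv g ◁ h′ ∷ h ∷ r ≡ h ∷ r) (inv-involutive g) (◁-cancel (inv g) (h ∷ r))

  _◁?_ : Maybe Gen → List Gen → List Gen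
  nothing ◁? k = k
  just g ◁? k = g ◁ k

  ◁?-reduced : ∀ e k → Reduced k → Reduced (e ◁? k)
  ◁?-reduced nothing k p = p
  ◁?-reduced (just g) k p = ◁-reduced g k p

  ◁?-inv-cancel : ∀ e k → Reduced k → e ◁? Maybe.map inv e ◁? k ≡ k
  ◁?-inv-cancel nothing k _ = refl
  ◁?-inv-cancel (just g) k p = subst (λ h → h ◁ inv g ◁ k ≡ k) (inv-involutive g) (inv-◁-◁ (inv g) k p)

  sideB≢sideA : ∀ {i j : I} → (i , sideB) ≢ (j , sideA)
  sideB≢sideA ()

  Pure : I → List Gen → Set
  Pure j = All (λ g → proj₁ g ≡ j)

  pure? : ∀ j k → Dec (Pure j k)
  pure? j = all? (λ g → proj₁ g ≟ᴵ j)

  Pure-head : ∀ {j g} k → Pure j k → head k ≡ just g → proj₁ g ≡ j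
  Pure-head (_ ∷ _) (g≡j ∷ _) refl = g≡j

  ◁-pure : ∀ {j} g k → proj₁ g ≡ j → Pure j k → Pure j (g ◁ k)
  ◁-pure g [] g≡ _ = g≡ ∷ []
  ◁-pure g (h ∷ r) g≡ p with h ≟ inv g
  ... | yes _ = All.tail p
  ... | no _ = g≡ ∷ p

  label : Gen → List Gen → Gen
  label c [] = c
  label c (g ∷ r) with pure? (proj₁ c) (g ∷ r)
  ... | yes _ = c
  ... | no _ = g

  label-pure : ∀ c k → Pure (proj₁ c) k → label c k ≡ c
  label-pure c [] _ = refl
  label-pure c (g ∷ r) p with pure? (proj₁ c) (g ∷ r)
  ... | yes _ = refl
  ... | no ¬p = ⊥-elim (¬p p)

  label-impure : ∀ c g r → ¬ Pure (proj₁ c) (g ∷ r) → label c (g ∷ r) ≡ g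
  label-impure c g r ¬p with pure? (proj₁ c) (g ∷ r)
  ... | yes p = ⊥-elim (¬p p)
  ... | no _ = refl

  label-head : ∀ d k → label (fromMaybe d (head k)) k ≡ fromMaybe d (head k)
  label-head d [] = refl
  label-head d (g ∷ r) with pure? (proj₁ g) (g ∷ r)
  ... | yes _ = refl
  ... | no _ = refl

  label-after-sideB : ∀ c i r → Reduced ((i , sideB) ∷ r) →
    ¬ Pure (proj₁ c) ((i , sideB) ∷ r) → label c r ≢ (i , sideA)
  label-after-sideB c i r red ¬p lr with pure? (proj₁ c) r
  ... | yes q with trans (sym (label-pure c r q)) lr
  ... | refl = ¬p (refl ∷ q)
  label-after-sideB c i [] _ _ _ | no ¬q = ¬q []
  label-after-sideB c i (h ∷ r) red _ lr | no ¬q =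
    Reduced-head (i , sideB) (h ∷ r) red (cong just (trans (sym (label-impure c h r ¬q)) lr))

  label-◁-sideA : ∀ c i k → Reduced k →
    label c k ≡ (i , sideB) → label c ((i , sideA) ◁ k) ≢ (i , sideA)
  label-◁-sideA c i k _ lk with pure? (proj₁ c) k
  label-◁-sideA c i k _ lk | yes p with trans (sym (label-pure c k p)) lk
  ... | refl = λ e → sideB≢sideA (trans (sym (label-pure c ((i , sideA) ◁ k) (◁-pure _ k refl p))) e)
  label-◁-sideA c i [] _ _ | no ¬p = ⊥-elim (¬p [])
  label-◁-sideA c i (h ∷ r) red lk | no ¬p with trans (sym (label-impure c h r ¬p)) lk
  ... | refl rewrite ◁-cancel (i , sideA) r = label-after-sideB c i r red ¬p

  label-◁-sideB : ∀ c i k → Reduced k →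
    label c k ≢ (i , sideA) → label c ((i , sideB) ◁ k) ≡ (i , sideB)
  label-◁-sideB c i k _ lk with pure? (proj₁ c) k
  label-◁-sideB (j , x) i k _ lk | yes p with j ≟ᴵ i
  label-◁-sideB (j , sideA) i k _ lk | yes p | yes refl = ⊥-elim (lk (label-pure (j , sideA) k p))
  label-◁-sideB (j , sideB) i k _ lk | yes p | yes refl =
    label-pure (j , sideB) _ (◁-pure (i , sideB) k refl p)
  label-◁-sideB (j , x) i k _ lk | yes p | no j≢i
    rewrite ◁-extend (i , sideB) k (λ e → j≢i (sym (Pure-head k p e))) =
    label-impure (j , x) (i , sideB) k (λ q → j≢i (sym (All.head q)))
  label-◁-sideB c i [] _ _ | no ¬p = ⊥-elim (¬p [])
  label-◁-sideB c i (h ∷ r) _ lk | no ¬p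
    rewrite ◁-extend (i , sideB) (h ∷ r) (λ e → lk (trans (label-impure c h r ¬p) (just-injective e))) =
    label-impure c (i , sideB) (h ∷ r) (¬p ∘ All.tail)

clampFin : (M : ℕ) → ℕ → Fin (suc M)
clampFin M zero = fzero
clampFin zero (suc _) = fzero
clampFin (suc M) (suc m) = fsuc (clampFin M m)

clampFin-toℕ : ∀ M (k : Fin (suc M)) → clampFin M (toℕ k) ≡ k
clampFin-toℕ M fzero = refl
clampFin-toℕ (suc M) (fsuc k) = cong fsuc (clampFin-toℕ M k)

-- State q ≤ N stands for the coset representative σ^{-q}, and reading the letter a in
-- state q rewrites σ^{-q} a as e σ^{-next q a}, where e (if any) is the letter emit q a.
module Schreier (N : ℕ) where

  n : ℕ
  n = suc (suc N)

  open FreeWord (_≟ᶠ_ {n}) public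

  next : ℕ → Letter → ℕ
  next m s⁻ with m <? N
  ... | yes _ = suc m
  ... | no _ = zero
  next zero s = N
  next (suc m) s = m
  next zero t = N
  next (suc m) t = m
  next m t⁻ with m <? N
  ... | yes _ = suc m
  ... | no _ = zero

  emit : ℕ → Letter → Maybe Gen
  emit m s⁻ with m <? N
  ... | yes _ = nothing
  ... | no _ = just (fzero , sideB)
  emit zero s = just (fzero , sideA)
  emit (suc m) s = nothing
  emit zero t = just (fsuc fzero , sideA)
  emit (suc m) t = just (clampFin (suc N) (suc (suc m)) , sideA)
  emit m t⁻ with m <? N
  ... | yes _ = just (clampFin (suc N) (suc (suc m)) , sideB)
  ... | no _ = just (fsuc fzero , sideB)

  next-≤ : ∀ q a → q ≤ N → next q a ≤ N
  next-≤ q s⁻ _ with q <? N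
  ... | yes q<N = q<N
  ... | no _ = z≤n
  next-≤ zero s _ = ≤-refl
  next-≤ (suc m) s le = <⇒≤ le
  next-≤ zero t _ = ≤-refl
  next-≤ (suc m) t le = <⇒≤ le
  next-≤ q t⁻ _ with q <? N
  ... | yes q<N = q<N
  ... | no _ = z≤n

  next-invL : ∀ q a → q ≤ N →
    next (next q a) (invL a) ≡ q × emit (next q a) (invL a) ≡ Maybe.map inv (emit q a)
  next-invL q s⁻ le with q <? N
  ... | yes _ = refl , refl
  ... | no q≮N with ≤-antisym le (≮⇒≥ q≮N)
  ... | refl = refl , refl
  next-invL zero s _ with N <? N
  ... | yes N<N = ⊥-elim (<-irrefl refl N<N)
  ... | no _ = refl , refl
  next-invL (suc m) s le with m <? N
  ... | yes _ = refl , refl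
  ... | no m≮N = ⊥-elim (m≮N le)
  next-invL zero t _ with N <? N
  ... | yes N<N = ⊥-elim (<-irrefl refl N<N)
  ... | no _ = refl , refl
  next-invL (suc m) t le with m <? N
  ... | yes _ = refl , refl
  ... | no m≮N = ⊥-elim (m≮N le)
  next-invL q t⁻ le with q <? N
  ... | yes _ = refl , refl
  ... | no q≮N with ≤-antisym le (≮⇒≥ q≮N)
  ... | refl = refl , refl

  schreier : ℕ → List Letter → List Gen
  schreier q [] = []
  schreier q (a ∷ w) = emit q a ◁? schreier (next q a) w

  schreier-reduced : ∀ q w → Reduced (schreier q w)
  schreier-reduced q [] = tt
  schreier-reduced q (a ∷ w) = ◁?-reduced (emit q a) _ (schreier-reduced (next q a) w)

  schreier-cons : ∀ q a w → q ≤ N → schreier q (cons a w) ≡ schreier q (a ∷ w)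
  schreier-cons q a [] _ = refl
  schreier-cons q a (b ∷ w) le with cancels a b in eq
  ... | false = refl
  ... | true rewrite cancels⇒≡invL a b eq with next-invL q a le
  ... | next≡ , emit≡ rewrite next≡ | emit≡ = sym (◁?-inv-cancel (emit q a) (schreier q w) (schreier-reduced q w))

  next* : ℕ → List Letter → ℕ
  next* q [] = q
  next* q (a ∷ u) = next* (next q a) u

  emit* : ℕ → List Letter → List Gen → List Gen
  emit* q [] k = k
  emit* q (a ∷ u) k = emit q a ◁? emit* (next q a) u k

  schreier-mulW : ∀ q u x → q ≤ N → schreier q (mulW u x) ≡ emit* q u (schreier (next* q u) x)
  schreier-mulW q [] x _ = refl
  schreier-mulW q (a ∷ u) x le = begin
    schreier q (cons a (mulW u x))                         ≡⟨ schreier-cons q a (mulW u x) le ⟩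
    emit q a ◁? schreier (next q a) (mulW u x)             ≡⟨ cong (emit q a ◁?_) (schreier-mulW (next q a) u x (next-≤ q a le)) ⟩
    emit q a ◁? emit* (next q a) u (schreier (next* (next q a) u) x) ∎
    where open ≡-Reasoning

  record Walk (p : ℕ) (u : List Letter) (q : ℕ) (f : List Gen → List Gen) : Set where
    constructor walk
    field
      ends  : next* p u ≡ q
      emits : ∀ k → emit* p u k ≡ f k

  walk-∷ : ∀ {p a p′ e u q f} → next p a ≡ p′ → emit p a ≡ e →
    Walk p′ u q f → Walk p (a ∷ u) q ((e ◁?_) ∘ f)
  walk-∷ {p} {a} refl refl (walk ends emits) = walk ends λ k → cong (emit p a ◁?_) (emits k)

  walk-σ^ : ∀ m → Walk m (replicate m s) 0 (λ k → k)
  walk-σ^ zero = walk refl λ _ → refl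
  walk-σ^ (suc m) = walk-∷ refl refl (walk-σ^ m)

  step-σ⁻¹ : ∀ {m} → m < N → next m s⁻ ≡ suc m × emit m s⁻ ≡ nothing
  step-σ⁻¹ {m} m<N with m <? N
  ... | yes _ = refl , refl
  ... | no m≮N = ⊥-elim (m≮N m<N)

  walk-σ⁻¹^ : ∀ c m {v q f} → m + c ≤ N → Walk (m + c) v q f → Walk m (replicate c s⁻ ++ v) q f
  walk-σ⁻¹^ zero m {v} {q} {f} _ w = subst (λ p → Walk p v q f) (+-identityʳ m) w
  walk-σ⁻¹^ (suc c) m {v} {q} {f} le w =
    walk-∷ (proj₁ step) (proj₂ step) (walk-σ⁻¹^ c (suc m) le′ (subst (λ p → Walk p v q f) (+-suc m c) w))
    where
    le′ : suc m + c ≤ N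
    le′ = subst (_≤ N) (+-suc m c) le
    step = step-σ⁻¹ (≤-trans (s≤s (m≤m+n m c)) le′)

  walk-γ : ∀ i → Walk 0 (proj₁ (γ n i)) 0 ((i , sideA) ◁_)
  walk-γ fzero rewrite letter-^ s (suc N) = walk-∷ refl refl (walk-σ^ N)
  walk-γ (fsuc fzero) rewrite letter-^ s N | cons-t-σ^ N = walk-∷ refl refl (walk-σ^ N)
  walk-γ (fsuc (fsuc k)) rewrite γ-word (toℕ k) =
    subst (λ j → Walk 0 (replicate (suc (toℕ k)) s⁻ ++ t ∷ replicate (toℕ k) s) 0 ((j , sideA) ◁_))
      (cong fsuc (clampFin-toℕ N (fsuc k)))
      (walk-σ⁻¹^ (suc (toℕ k)) 0 (toℕ<n k) (walk-∷ refl refl (walk-σ^ (toℕ k))))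

  schreier-γ : ∀ i x → schreier 0 (mulW (proj₁ (γ n i)) x) ≡ (i , sideA) ◁ schreier 0 x
  schreier-γ i x = begin
    schreier 0 (mulW u x)               ≡⟨ schreier-mulW 0 u x z≤n ⟩
    emit* 0 u (schreier (next* 0 u) x)  ≡⟨ cong (λ q → emit* 0 u (schreier q x)) ends ⟩
    emit* 0 u (schreier 0 x)            ≡⟨ emits _ ⟩
    (i , sideA) ◁ schreier 0 x          ∎
    where
    open ≡-Reasoning
    open Walk (walk-γ i)
    u = proj₁ (γ n i)

  Φ : F2 → List Gen
  Φ x = schreier 0 (proj₁ x)

  Φ-reduced : ∀ x → Reduced (Φ x)
  Φ-reduced x = schreier-reduced 0 (proj₁ x)

  Φ-γ : ∀ i x → Φ (γ n i · x) ≡ (i , sideA) ◁ Φ x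
  Φ-γ i x = schreier-γ i (proj₁ x)

  label-Φ-γ : ∀ c i β → label c (Φ β) ≡ (i , sideB) → label c (Φ (γ n i · β)) ≢ (i , sideA)
  label-Φ-γ c i β labβ rewrite Φ-γ i β = label-◁-sideA c i (Φ β) (Φ-reduced β) labβ

  label-Φ-γ⁻¹ : ∀ c i x → label c (Φ x) ≢ (i , sideA) →
    ∃ λ β → label c (Φ β) ≡ (i , sideB) × γ n i · β ≡ x
  label-Φ-γ⁻¹ c i x labx with ·-divideˡ (γ n i) x
  ... | β , refl = β , labβ , refl
    where
    open ≡-Reasoning
    labβ : label c (Φ β) ≡ (i , sideB)
    labβ = begin
      label c (Φ β)                                ≡⟨ cong (label c) (inv-◁-◁ (i , sideA) (Φ β) (Φ-reduced β)) ⟨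
      label c ((i , sideB) ◁ (i , sideA) ◁ Φ β)    ≡⟨ cong (λ k → label c ((i , sideB) ◁ k)) (Φ-γ i β) ⟨
      label c ((i , sideB) ◁ Φ (γ n i · β))        ≡⟨ label-◁-sideB c i _ (Φ-reduced (γ n i · β)) labx ⟩
      (i , sideB)                                  ∎

theorem2p5 : (n : ℕ) → 2 ≤ n → (ω : F2) →
    Σ (F2 → Fin n × Side) (λ lab →
      (lab ε ≡ lab ω) ×
      ((i : Fin n) →
        (γ n i ⟨ (λ x → lab x ≡ (i , sideB)) ⟩) ≐ ∁ (λ x → lab x ≡ (i , sideA))))
theorem2p5 (suc (suc N)) (s≤s (s≤s z≤n)) ω =
  lab , sym (label-head _ (Φ ω)) , λ i → (λ { (β , labβ , refl) → label-Φ-γ c i β labβ }) , label-Φ-γ⁻¹ c i _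
  where
  open Schreier N
  c : Gen
  c = fromMaybe (fzero , sideA) (head (Φ ω))
  lab : F2 → Gen
  lab x = label c (Φ x)
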